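{- Let $n \ge 5$ and let $G$ be the symmetric group $S_n$ or the alternating group $A_n$ in its natural action on $\mathcal{P}=\{1,2,\dots,n\}$. Then there are exactly $n-4$ non-trivial $2$-$(v,k,\lambda)$ designs with point set $\mathcal{P}$ on which $G$ acts as a flag-transitive, point-primitive automorphism group, and all of them are full designs. Their parameters $(v,b,r,k,\lambda)$ are $$\left(n,\ \binom{n}{k},\ \binom{n-1}{k-1},\ k,\ \binom{n-2}{k-2}\right),\qquad k\in\{3,4,\dots,n-2\},$$ where $\binom{n}{k}=\frac{n(n-1)\cdots(n-k+1)}{k(k-1)\cdots 1}$.
   Context: A $2$-$(v,k,\lambda)$ design $\mathcal{D}=(\mathcal{P},\mathcal{B})$ consists of a set $\mathcal{P}$ of $v$ points and a family $\mathcal{B}$ of $b$ distinct $k$-subsets (blocks) of $\mathcal{P}$ such that every two distinct points lie in exactly $\lambda$ blocks; then every point lies in exactly $r$ blocks, with $vr=bk$ and $\lambda(v-1)=r(k-1)$. The design is non-trivial if $2<k<v-1$. It is a full design if $\mathcal{B}$ consists of all $k$-subsets of $\mathcal{P}$. An automorphism is a permutation of $\mathcal{P}$ mapping blocks to blocks. A flag is a pair $(\alpha,B)$ with $\alpha\in B\in\mathcal{B}$; a group $G$ of automorphisms is flag-transitive if it is transitive on flags, and point-primitive if it acts primitively on $\mathcal{P}$. -}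

module Defs where

open import Data.Nat using (ℕ; zero; suc; _+_; _∸_; _≤_; _<_; _%_; _≡ᵇ_)
open import Data.Nat.Combinatorics using (_C_)
open import Data.Bool using (Bool; true; false; _∧_; if_then_else_)
open import Data.Fin using (Fin; toℕ; _<?_)
open import Data.Fin.Subset using (Subset; _∈_; _∩_; ∣_∣; ⊤; Empty; inside; outside)
open import Data.Fin.Subset.Properties using (_∈?_)
open import Data.Fin.Permutation using (Permutation′; _⟨$⟩ʳ_; _⟨$⟩ˡ_)
open import Data.Vec using (Vec; []; _∷_; tabulate; lookup)
open import Data.List using (List; []; _∷_; map; _++_; length; filterᵇ; allFin)
open import Data.Nat.ListAction using (sum)
open import Data.Unit using () renaming (⊤ to Unit)
open import Data.Product using (Σ; ∃; ∃₂; _×_; _,_)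
open import Data.Sum using (_⊎_)
open import Relation.Binary.PropositionalEquality using (_≡_; _≢_)
open import Relation.Nullary.Decidable using (⌊_⌋)

allSubsets : (n : ℕ) → List (Subset n)
allSubsets zero = [] ∷ []
allSubsets (suc n) = map (inside ∷_) (allSubsets n) ++ map (outside ∷_) (allSubsets n)

-- A family of distinct blocks on point set Fin n, given by its characteristic function.
Blocks : ℕ → Set
Blocks n = Subset n → Bool

countSubsets : ∀ {n} → (Subset n → Bool) → ℕ
countSubsets {n} P = length (filterᵇ P (allSubsets n))

has : ∀ {n} → Fin n → Subset n → Bool
has x S = lookup S x

Is2Design : (n : ℕ) → Blocks n → (k lam : ℕ) → Set
Is2Design n B k lam =
  (∀ S → B S ≡ true → ∣ S ∣ ≡ k) ×
  (∀ (x y : Fin n) → x ≢ y → countSubsets (λ S → B S ∧ has x S ∧ has y S) ≡ lam) ×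
  (1 ≤ lam)

NonTrivial : ℕ → ℕ → Set
NonTrivial v k = 2 < k × k < v ∸ 1

fullDesign : (n k : ℕ) → Blocks n
fullDesign n k S = ∣ S ∣ ≡ᵇ k

_≐_ : ∀ {n} → Blocks n → Blocks n → Set
B ≐ C = ∀ S → B S ≡ C S

image : ∀ {n} → Permutation′ n → Subset n → Subset n
image g S = tabulate (λ j → lookup S (g ⟨$⟩ˡ j))

inversions : ∀ {n} → Permutation′ n → ℕ
inversions {n} g =
  sum (map (λ i → length (filterᵇ (λ j → ⌊ i <? j ⌋ ∧ ⌊ g ⟨$⟩ʳ j <? g ⟨$⟩ʳ i ⌋) (allFin n))) (allFin n))

data Which : Set where
  Sym Alt : Which

InG : ∀ {n} → Which → Permutation′ n → Set
InG Sym g = Unit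
InG Alt g = inversions g % 2 ≡ 0

Group′ : ℕ → Set₁
Group′ n = Permutation′ n → Set

IsAutGroup : ∀ {n} → Group′ n → Blocks n → Set
IsAutGroup {n} G B = ∀ g → G g → ∀ S → B S ≡ true → B (image g S) ≡ true

FlagTransitive : ∀ {n} → Group′ n → Blocks n → Set
FlagTransitive {n} G B =
  ∀ (α β : Fin n) (S T : Subset n) → B S ≡ true → α ∈ S → B T ≡ true → β ∈ T →
  ∃ λ g → G g × g ⟨$⟩ʳ α ≡ β × image g S ≡ T

Transitive : ∀ {n} → Group′ n → Set
Transitive {n} G = ∀ (α β : Fin n) → ∃ λ g → G g × g ⟨$⟩ʳ α ≡ β

IsBlockOfImprimitivity : ∀ {n} → Group′ n → Subset n → Set
IsBlockOfImprimitivity G Δ = ∀ g → G g → image g Δ ≡ Δ ⊎ Empty (image g Δ ∩ Δ)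

Primitive : ∀ {n} → Group′ n → Set
Primitive {n} G = Transitive G × (∀ Δ → IsBlockOfImprimitivity G Δ → ∣ Δ ∣ ≤ 1 ⊎ Δ ≡ ⊤)

Good : (n : ℕ) → Group′ n → Blocks n → Set
Good n G B =
  (∃₂ λ k lam → Is2Design n B k lam × NonTrivial n k) ×
  IsAutGroup G B × FlagTransitive G B × Primitive G

-- S_n, and A_n for n ≥ 5, act flag-transitively on the k-subsets of the points
-- whenever k ≤ n − 2: two flags α ∈ S, β ∈ T with |S| = |T| are matched by some permutation, and
-- if it is odd, following it by the transposition of two points outside T makes it even while
-- keeping the flag (a transposition changes the parity of the number of inversions). So a
-- nonempty k-uniform block set invariant under the group contains every k-subset: each admissible
-- design is a full design. Conversely every full design with 2 < k < n − 1 qualifies, with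
-- λ = C(n − 2, k − 2) by Pascal's rule, and primitivity follows from transitivity on 2-subsets.
module Submission where

open import Algebra.Bundles using (CommutativeRing)
import Algebra.Properties.CommutativeMonoid.Sum as CommutativeMonoidSum
import Algebra.Properties.Semiring.Sum as SemiringSum
open import Data.Bool using (Bool; true; false; not; _∧_; _xor_)
import Data.Bool.Properties as Boolₚ
open import Data.Empty using (⊥; ⊥-elim)
open import Data.Fin as Fin using (Fin; zero; suc; toℕ; _<?_)
import Data.Fin.Properties as Finₚ
open Finₚ using (_≟_)
open import Data.Fin.Permutation as Perm using (Permutation′; _⟨$⟩ʳ_; _⟨$⟩ˡ_; _∘ₚ_; transpose)
import Data.Fin.Permutation.Components as PC
open import Data.Fin.Subset using (Subset; Nonempty; inside; outside; ∣_∣; _∈_; _∉_; _⊆_; ⁅_⁆; _∪_; ∁; ⊤)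
import Data.Fin.Subset.Properties as Subsetₚ
open import Data.List as List using ([]; _∷_; filterᵇ; tabulate)
import Data.List.Properties as Listₚ
open import Data.Nat as ℕ using (ℕ; zero; suc; _+_; _∸_; _%_; _≡ᵇ_; _≤_; _<_; z≤n; s≤s)
open import Data.Nat.Combinatorics using (_C_; nCk+nC[k+1]≡[n+1]C[k+1])
open import Data.Nat.ListAction using (sum)
import Data.Nat.Properties as ℕₚ
open import Data.Product using (Σ; ∃; ∃₂; _×_; _,_; proj₁; proj₂)
open import Data.Sum using (_⊎_; inj₁; inj₂)
open import Data.Vec using ([]; _∷_; lookup; here; there)
import Data.Vec.Properties as Vecₚ
open import Function using (_∘_; id; flip; _⇔_; mk⇔; Equivalence)
open import Function.Bundles using (Injection)
import Function.Properties.Equivalence as ⇔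
open import Function.Properties.Inverse using (Inverse⇒Injection)
open import Relation.Binary using (tri<; tri≈; tri>)
open import Relation.Binary.PropositionalEquality
open import Relation.Nullary using (Dec; yes; no; ¬_)
open import Relation.Nullary.Decidable using (T?; ⌊_⌋; isYes≗does; dec-true; dec-false; does-⇔; ⌊⌋-map′)

open import Defs

open CommutativeMonoidSum ℕₚ.+-0-commutativeMonoid using ()
  renaming (sum to ∑; sum-cong-≗ to ℕ-sum-cong; sum-permute to ℕ-sum-permute)
-- ⨁ sums in the ring (Bool, xor, ∧), i.e. modulo 2.
module ⨁ₚ = SemiringSum (CommutativeRing.semiring Boolₚ.xor-∧-commutativeRing)
open ⨁ₚ using () renaming (sum to ⨁)
open CommutativeMonoidSum (CommutativeRing.+-commutativeMonoid Boolₚ.xor-∧-commutativeRing)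
  using () renaming (∑-distrib-+ to ⨁-distrib-xor)

isYes-true : ∀ {A : Set} (a? : Dec A) → A → ⌊ a? ⌋ ≡ true
isYes-true a? a = trans (isYes≗does a?) (dec-true a? a)

isYes-false : ∀ {A : Set} (a? : Dec A) → ¬ A → ⌊ a? ⌋ ≡ false
isYes-false a? ¬a = trans (isYes≗does a?) (dec-false a? ¬a)

isYes-⇔ : ∀ {A B : Set} → A ⇔ B → (a? : Dec A) (b? : Dec B) → ⌊ a? ⌋ ≡ ⌊ b? ⌋
isYes-⇔ A⇔B a? b? = trans (isYes≗does a?) (trans (does-⇔ A⇔B a? b?) (sym (isYes≗does b?)))

xor-true : ∀ x → x xor true ≡ not x
xor-true x = trans (Boolₚ.xor-comm x true) (Boolₚ.true-xor x)

<?-flip : ∀ {n} {x y : Fin n} → x ≢ y → ⌊ x <? y ⌋ ≡ not ⌊ y <? x ⌋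
<?-flip {x = x} {y} x≢y with Finₚ.<-cmp x y
... | tri< x<y _ y≮x = trans (isYes-true (x <? y) x<y) (cong not (sym (isYes-false (y <? x) y≮x)))
... | tri≈ _ x≡y _   = ⊥-elim (x≢y x≡y)
... | tri> x≮y _ y<x = trans (isYes-false (x <? y) x≮y) (cong not (sym (isYes-true (y <? x) y<x)))

n≡1+[n∸1+m]+m : ∀ {m n} → m < n → n ≡ suc (n ∸ suc m + m)
n≡1+[n∸1+m]+m m<n = trans (sym (ℕₚ.m∸n+n≡m m<n)) (ℕₚ.+-suc _ _)

-- Parity of the number of inversions

indicator : Bool → ℕ
indicator true  = 1
indicator false = 0

count : ∀ {n} → (Fin n → Bool) → ℕ
count p = ∑ (indicator ∘ p)

length-filterᵇ-tabulate : ∀ {A : Set} {n} (p : A → Bool) (f : Fin n → A) →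
  List.length (filterᵇ p (tabulate f)) ≡ count (p ∘ f)
length-filterᵇ-tabulate {n = zero}  p f = refl
length-filterᵇ-tabulate {n = suc n} p f with p (f zero)
... | true  = cong suc (length-filterᵇ-tabulate p (f ∘ suc))
... | false = length-filterᵇ-tabulate p (f ∘ suc)

sum-map-tabulate : ∀ {A : Set} {n} (h : A → ℕ) (f : Fin n → A) →
  sum (List.map h (tabulate f)) ≡ ∑ (h ∘ f)
sum-map-tabulate {n = zero}  h f = refl
sum-map-tabulate {n = suc n} h f = cong (h (f zero) +_) (sum-map-tabulate h (f ∘ suc))

parity : ℕ → Bool
parity zero    = false
parity (suc n) = not (parity n)

parity-+ : ∀ m n → parity (m + n) ≡ parity m xor parity n
parity-+ zero    n = refl
parity-+ (suc m) n = trans (cong not (parity-+ m n)) (Boolₚ.not-distribˡ-xor (parity m) (parity n))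

parity-∑ : ∀ {n} (f : Fin n → ℕ) → parity (∑ f) ≡ ⨁ (parity ∘ f)
parity-∑ {zero}  f = refl
parity-∑ {suc n} f = trans (parity-+ (f zero) (∑ (f ∘ suc))) (cong (parity (f zero) xor_) (parity-∑ (f ∘ suc)))

parity-count : ∀ {n} (p : Fin n → Bool) → parity (count p) ≡ ⨁ p
parity-count p = trans (parity-∑ (indicator ∘ p)) (⨁ₚ.sum-cong-≗ (parity-indicator ∘ p))
  where
  parity-indicator : ∀ b → parity (indicator b) ≡ b
  parity-indicator true  = refl
  parity-indicator false = refl

parity≡false⇒%2≡0 : ∀ n → parity n ≡ false → n % 2 ≡ 0
parity≡false⇒%2≡0 zero          _ = refl
parity≡false⇒%2≡0 (suc zero)    ()
parity≡false⇒%2≡0 (suc (suc n)) e = parity≡false⇒%2≡0 n (trans (sym (Boolₚ.not-involutive (parity n))) e)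

inverted : ∀ {n} → (Fin n → Fin n) → Fin n → Fin n → Bool
inverted f i j = ⌊ i <? j ⌋ ∧ ⌊ f j <? f i ⌋

inversionParity : ∀ {n} → (Fin n → Fin n) → Bool
inversionParity f = ⨁ λ i → ⨁ λ j → inverted f i j

isOdd : ∀ {n} → Permutation′ n → Bool
isOdd g = inversionParity (g ⟨$⟩ʳ_)

inversionParity-cong : ∀ {n} {f h : Fin n → Fin n} → (∀ x → f x ≡ h x) → inversionParity f ≡ inversionParity h
inversionParity-cong {n} f≗h =
  ⨁ₚ.sum-cong-≗ {n} λ i → ⨁ₚ.sum-cong-≗ {n} λ j → cong₂ (λ u v → ⌊ i <? j ⌋ ∧ ⌊ u <? v ⌋) (f≗h j) (f≗h i)

parity-inversions : ∀ {n} (g : Permutation′ n) → parity (inversions g) ≡ isOdd g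
parity-inversions {n} g = begin
  parity (inversions g)
    ≡⟨ cong parity (sum-map-tabulate rowCount id) ⟩
  parity (∑ rowCount)
    ≡⟨ cong parity (ℕ-sum-cong λ i → length-filterᵇ-tabulate (inverted f i) id) ⟩
  parity (∑ λ i → count (inverted f i))
    ≡⟨ parity-∑ (λ i → count (inverted f i)) ⟩
  (⨁ λ i → parity (count (inverted f i)))
    ≡⟨ ⨁ₚ.sum-cong-≗ (λ i → parity-count (inverted f i)) ⟩
  isOdd g ∎
  where
  open ≡-Reasoning
  f : Fin n → Fin n
  f = g ⟨$⟩ʳ_
  rowCount : Fin n → ℕ
  rowCount i = List.length (filterᵇ (inverted f i) (List.allFin n))

⨁-δ : ∀ {n} (q : Fin n) → ⨁ (λ j → ⌊ j ≟ q ⌋) ≡ true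
⨁-δ {suc n} zero    = cong (true xor_) (⨁ₚ.sum-replicate-zero n)
⨁-δ {suc n} (suc q) = trans (⨁ₚ.sum-cong-≗ λ j → ⌊⌋-map′ (cong suc) Finₚ.suc-injective (j ≟ q)) (⨁-δ q)

⨁⨁-δ : ∀ {n} (p q : Fin n) → (⨁ λ i → ⨁ λ j → ⌊ i ≟ p ⌋ ∧ ⌊ j ≟ q ⌋) ≡ true
⨁⨁-δ {n} p q = begin
  (⨁ λ i → ⨁ λ j → ⌊ i ≟ p ⌋ ∧ ⌊ j ≟ q ⌋)
    ≡⟨ ⨁ₚ.sum-cong-≗ {n} (λ i → sym (⨁ₚ.*-distribˡ-sum ⌊ i ≟ p ⌋ (λ j → ⌊ j ≟ q ⌋))) ⟩
  (⨁ λ i → ⌊ i ≟ p ⌋ ∧ ⨁ λ j → ⌊ j ≟ q ⌋)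
    ≡⟨ ⨁ₚ.sum-cong-≗ {n} (λ i → cong (⌊ i ≟ p ⌋ ∧_) (⨁-δ q)) ⟩
  (⨁ λ i → ⌊ i ≟ p ⌋ ∧ true)
    ≡⟨ ⨁ₚ.sum-cong-≗ {n} (λ i → Boolₚ.∧-identityʳ _) ⟩
  (⨁ λ i → ⌊ i ≟ p ⌋)
    ≡⟨ ⨁-δ p ⟩
  true ∎
  where open ≡-Reasoning

transpose-≡ˡ : ∀ {n} (i j : Fin n) → PC.transpose i j i ≡ j
transpose-≡ˡ i j rewrite dec-true (i ≟ i) refl = refl

transpose-≡ʳ : ∀ {n} (i j : Fin n) → PC.transpose i j j ≡ i
transpose-≡ʳ i j with j ≟ i
... | yes j≡i = j≡i
... | no  _   rewrite dec-true (j ≟ j) refl = refl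

transpose-≢ : ∀ {n} {i j k : Fin n} → k ≢ i → k ≢ j → PC.transpose i j k ≡ k
transpose-≢ {i = i} {j} {k} k≢i k≢j
  rewrite dec-false (k ≟ i) k≢i | dec-false (k ≟ j) k≢j = refl

transpose-comm : ∀ {n} (a b x : Fin n) → PC.transpose a b x ≡ PC.transpose b a x
transpose-comm a b x = cases (x ≟ a) (x ≟ b)
  where
  cases : Dec (x ≡ a) → Dec (x ≡ b) → PC.transpose a b x ≡ PC.transpose b a x
  cases (yes refl) _          = trans (transpose-≡ˡ x b) (sym (transpose-≡ʳ b x))
  cases (no _)     (yes refl) = trans (transpose-≡ʳ a x) (sym (transpose-≡ˡ x a))
  cases (no x≢a)   (no x≢b)   = trans (transpose-≢ x≢a x≢b) (sym (transpose-≢ x≢b x≢a))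

transpose-conjugate : ∀ {n} {a a′ b : Fin n} → a ≢ a′ → a ≢ b → a′ ≢ b → ∀ x →
  PC.transpose a b x ≡ PC.transpose a a′ (PC.transpose a′ b (PC.transpose a a′ x))
transpose-conjugate {a = a} {a′} {b} a≢a′ a≢b a′≢b x = cases (x ≟ a) (x ≟ a′) (x ≟ b)
  where
  cases : Dec (x ≡ a) → Dec (x ≡ a′) → Dec (x ≡ b) →
          PC.transpose a b x ≡ PC.transpose a a′ (PC.transpose a′ b (PC.transpose a a′ x))
  cases (yes refl) _ _
    rewrite transpose-≡ˡ a b | transpose-≡ˡ a a′ | transpose-≡ˡ a′ b | transpose-≢ (a≢b ∘ sym) (a′≢b ∘ sym) = refl
  cases (no x≢a) (yes refl) _
    rewrite transpose-≢ x≢a a′≢b | transpose-≡ʳ a a′ | transpose-≢ a≢a′ a≢b | transpose-≡ˡ a a′ = refl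
  cases (no x≢a) (no x≢a′) (yes refl)
    rewrite transpose-≡ʳ a b | transpose-≢ x≢a x≢a′ | transpose-≡ʳ a′ b | transpose-≡ʳ a a′ = refl
  cases (no x≢a) (no x≢a′) (no x≢b)
    rewrite transpose-≢ x≢a x≢b | transpose-≢ x≢a x≢a′ | transpose-≢ x≢a′ x≢b | transpose-≢ x≢a x≢a′ = refl

⟨$⟩ʳ-injective : ∀ {n} (g : Permutation′ n) {x y} → g ⟨$⟩ʳ x ≡ g ⟨$⟩ʳ y → x ≡ y
⟨$⟩ʳ-injective g = Injection.injective (Inverse⇒Injection g)

SamePair : ∀ {n} → Fin n → Fin n → Fin n → Fin n → Set
SamePair a b x y = (x ≡ a × y ≡ b) ⊎ (x ≡ b × y ≡ a)

SamePair-sym : ∀ {n} {a b x y : Fin n} → SamePair a b x y → SamePair a b y x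
SamePair-sym (inj₁ (x≡a , y≡b)) = inj₂ (y≡b , x≡a)
SamePair-sym (inj₂ (x≡b , y≡a)) = inj₁ (y≡a , x≡b)

transpose-SamePair : ∀ {n} {a b x y : Fin n} → SamePair a b x y → PC.transpose a b x ≡ y
transpose-SamePair {a = a} {b} (inj₁ (refl , refl)) = transpose-≡ˡ a b
transpose-SamePair {a = a} {b} (inj₂ (refl , refl)) = transpose-≡ʳ a b

-- Composing with the swap of the adjacent values a and a + 1 changes the relative order of
-- exactly one pair of positions: the two positions holding these values.
module AdjacentTransposition {n} {a b : Fin n} (b≡1+a : toℕ b ≡ suc (toℕ a)) where

  private
    t : Fin n → Fin n
    t = PC.transpose a b

  -- No point lies strictly between a and b.
  compare-adjacent : ∀ {z} → z ≢ a → z ≢ b → (z Fin.< a ⇔ z Fin.< b) × (a Fin.< z ⇔ b Fin.< z)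
  compare-adjacent {z} z≢a z≢b =
    mk⇔ (λ z<a → subst (toℕ z <_) (sym b≡1+a) (ℕₚ.m<n⇒m<1+n z<a))
        (λ z<b → ℕₚ.≤∧≢⇒< (ℕₚ.≤-pred (subst (toℕ z <_) b≡1+a z<b)) (z≢a ∘ Finₚ.toℕ-injective)) ,
    mk⇔ (λ a<z → ℕₚ.≤∧≢⇒< (subst (_≤ toℕ z) (sym b≡1+a) a<z) (z≢b ∘ sym ∘ Finₚ.toℕ-injective))
        (λ b<z → ℕₚ.<-trans (subst (toℕ a <_) (sym b≡1+a) (ℕₚ.n<1+n (toℕ a))) b<z)

  transpose-preserves-< : ∀ x y → ¬ SamePair a b x y → t x Fin.< t y ⇔ x Fin.< y
  transpose-preserves-< x y ¬pair with x ≟ y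
  ... | yes refl = mk⇔ (⊥-elim ∘ Finₚ.<-irrefl refl) (⊥-elim ∘ Finₚ.<-irrefl refl)
  ... | no x≢y = cases (x ≟ a) (x ≟ b) (y ≟ a) (y ≟ b)
    where
    cases : Dec (x ≡ a) → Dec (x ≡ b) → Dec (y ≡ a) → Dec (y ≡ b) → t x Fin.< t y ⇔ x Fin.< y
    cases (yes refl) _ _ (yes refl) = ⊥-elim (¬pair (inj₁ (refl , refl)))
    cases _ (yes refl) (yes refl) _ = ⊥-elim (¬pair (inj₂ (refl , refl)))
    cases (yes refl) _ (yes refl) _ = ⊥-elim (x≢y refl)
    cases _ (yes refl) _ (yes refl) = ⊥-elim (x≢y refl)
    cases (yes refl) _ (no y≢a) (no y≢b)
      rewrite transpose-≡ˡ a b | transpose-≢ y≢a y≢b = ⇔.sym (proj₂ (compare-adjacent y≢a y≢b))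
    cases (no x≢a) (yes refl) (no y≢a) (no y≢b)
      rewrite transpose-≡ʳ a b | transpose-≢ y≢a y≢b = proj₂ (compare-adjacent y≢a y≢b)
    cases (no x≢a) (no x≢b) (yes refl) _
      rewrite transpose-≡ˡ a b | transpose-≢ x≢a x≢b = ⇔.sym (proj₁ (compare-adjacent x≢a x≢b))
    cases (no x≢a) (no x≢b) (no y≢a) (yes refl)
      rewrite transpose-≡ʳ a b | transpose-≢ x≢a x≢b = proj₁ (compare-adjacent x≢a x≢b)
    cases (no x≢a) (no x≢b) (no y≢a) (no y≢b)
      rewrite transpose-≢ x≢a x≢b | transpose-≢ y≢a y≢b = mk⇔ id id

  module _ (f : Fin n → Fin n) (f-injective : ∀ {x y} → f x ≡ f y → x ≡ y)
           {p q : Fin n} (p<q : p Fin.< q) (pair : SamePair a b (f p) (f q)) where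

    private
      pair-positions : ∀ {i j} → i Fin.< j → SamePair a b (f j) (f i) → i ≡ p × j ≡ q
      pair-positions {i} {j} i<j = go pair
        where
        crossed : f i ≡ f q → f j ≡ f p → ⊥
        crossed fi≡fq fj≡fp = Finₚ.<-asym p<q (subst₂ Fin._<_ (f-injective fi≡fq) (f-injective fj≡fp) i<j)
        go : SamePair a b (f p) (f q) → SamePair a b (f j) (f i) → i ≡ p × j ≡ q
        go (inj₁ (fp , fq)) (inj₂ (fj , fi)) = f-injective (trans fi (sym fp)) , f-injective (trans fj (sym fq))
        go (inj₂ (fp , fq)) (inj₁ (fj , fi)) = f-injective (trans fi (sym fp)) , f-injective (trans fj (sym fq))
        go (inj₁ (fp , fq)) (inj₁ (fj , fi)) = ⊥-elim (crossed (trans fi (sym fq)) (trans fj (sym fp)))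
        go (inj₂ (fp , fq)) (inj₂ (fj , fi)) = ⊥-elim (crossed (trans fi (sym fq)) (trans fj (sym fp)))

      inverted-unchanged : ∀ i j → ¬ (i ≡ p × j ≡ q) → inverted (t ∘ f) i j ≡ inverted f i j
      inverted-unchanged i j ¬pq with i <? j
      ... | no  _   = refl
      ... | yes i<j =
        isYes-⇔ (transpose-preserves-< (f j) (f i) (¬pq ∘ pair-positions i<j)) (t (f j) <? t (f i)) (f j <? f i)

    inverted-transpose : ∀ i j → inverted (t ∘ f) i j ≡ inverted f i j xor (⌊ i ≟ p ⌋ ∧ ⌊ j ≟ q ⌋)
    inverted-transpose i j with i ≟ p | j ≟ q
    ... | yes refl | yes refl
      rewrite isYes-true (i <? j) p<q | transpose-SamePair pair | transpose-SamePair (SamePair-sym pair) =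
        trans (<?-flip (Finₚ.<⇒≢ p<q ∘ f-injective)) (sym (xor-true _))
    ... | yes _ | no j≢q = trans (inverted-unchanged i j (j≢q ∘ proj₂)) (sym (Boolₚ.xor-identityʳ _))
    ... | no i≢p | _     = trans (inverted-unchanged i j (i≢p ∘ proj₁)) (sym (Boolₚ.xor-identityʳ _))

    inversionParity-transpose : inversionParity (t ∘ f) ≡ not (inversionParity f)
    inversionParity-transpose = begin
      inversionParity (t ∘ f)
        ≡⟨ ⨁ₚ.sum-cong-≗ (λ i → ⨁ₚ.sum-cong-≗ (inverted-transpose i)) ⟩
      (⨁ λ i → ⨁ λ j → inverted f i j xor δ i j)
        ≡⟨ ⨁ₚ.sum-cong-≗ (λ i → ⨁-distrib-xor (inverted f i) (δ i)) ⟩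
      (⨁ λ i → (⨁ λ j → inverted f i j) xor (⨁ λ j → δ i j))
        ≡⟨ ⨁-distrib-xor (λ i → ⨁ (inverted f i)) (λ i → ⨁ (δ i)) ⟩
      inversionParity f xor (⨁ λ i → ⨁ λ j → δ i j)
        ≡⟨ cong (inversionParity f xor_) (⨁⨁-δ p q) ⟩
      inversionParity f xor true
        ≡⟨ xor-true _ ⟩
      not (inversionParity f) ∎
      where
      open ≡-Reasoning
      δ : Fin n → Fin n → Bool
      δ i j = ⌊ i ≟ p ⌋ ∧ ⌊ j ≟ q ⌋

  isOdd-∘-transpose : ∀ (g : Permutation′ n) → isOdd (g ∘ₚ transpose a b) ≡ not (isOdd g)
  isOdd-∘-transpose g with Finₚ.<-cmp (g ⟨$⟩ˡ a) (g ⟨$⟩ˡ b)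
  ... | tri< pa<pb _ _ =
    inversionParity-transpose (g ⟨$⟩ʳ_) (⟨$⟩ʳ-injective g) pa<pb (inj₁ (Perm.inverseʳ g , Perm.inverseʳ g))
  ... | tri≈ _ pa≡pb _ = ⊥-elim (a≢b (trans (sym (Perm.inverseʳ g)) (trans (cong (g ⟨$⟩ʳ_) pa≡pb) (Perm.inverseʳ g))))
    where a≢b : a ≢ b
          a≢b a≡b = ℕₚ.1+n≢n (sym (trans (cong toℕ a≡b) b≡1+a))
  ... | tri> _ _ pb<pa =
    inversionParity-transpose (g ⟨$⟩ʳ_) (⟨$⟩ʳ-injective g) pb<pa (inj₂ (Perm.inverseʳ g , Perm.inverseʳ g))

-- (a b) is the conjugate of (a′ b) by the adjacent transposition (a a′), where a′ = a + 1.
isOdd-∘-transpose-at-distance : ∀ d {n} (g : Permutation′ n) {a b : Fin n} → toℕ b ≡ suc (d + toℕ a) →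
  isOdd (g ∘ₚ transpose a b) ≡ not (isOdd g)
isOdd-∘-transpose-at-distance zero    g b≡1+a = AdjacentTransposition.isOdd-∘-transpose b≡1+a g
isOdd-∘-transpose-at-distance (suc d) {n} g {a} {b} b≡2+d+a = begin
  isOdd (g ∘ₚ transpose a b)
    ≡⟨ inversionParity-cong (transpose-conjugate a≢a′ a≢b a′≢b ∘ (g ⟨$⟩ʳ_)) ⟩
  isOdd (((g ∘ₚ transpose a a′) ∘ₚ transpose a′ b) ∘ₚ transpose a a′)
    ≡⟨ adjacent ((g ∘ₚ transpose a a′) ∘ₚ transpose a′ b) ⟩
  not (isOdd ((g ∘ₚ transpose a a′) ∘ₚ transpose a′ b))
    ≡⟨ cong not (isOdd-∘-transpose-at-distance d (g ∘ₚ transpose a a′) b≡1+d+a′) ⟩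
  not (not (isOdd (g ∘ₚ transpose a a′)))
    ≡⟨ Boolₚ.not-involutive _ ⟩
  isOdd (g ∘ₚ transpose a a′)
    ≡⟨ adjacent g ⟩
  not (isOdd g) ∎
  where
  open ≡-Reasoning
  1+a<b : suc (toℕ a) < toℕ b
  1+a<b = subst (suc (toℕ a) <_) (sym b≡2+d+a) (s≤s (s≤s (ℕₚ.m≤n+m (toℕ a) d)))
  1+a<n : suc (toℕ a) < n
  1+a<n = ℕₚ.<-trans 1+a<b (Finₚ.toℕ<n b)
  a′ : Fin n
  a′ = Fin.fromℕ< 1+a<n
  a′≡1+a : toℕ a′ ≡ suc (toℕ a)
  a′≡1+a = Finₚ.toℕ-fromℕ< 1+a<n
  adjacent : ∀ h → isOdd (h ∘ₚ transpose a a′) ≡ not (isOdd h)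
  adjacent = AdjacentTransposition.isOdd-∘-transpose a′≡1+a
  b≡1+d+a′ : toℕ b ≡ suc (d + toℕ a′)
  b≡1+d+a′ = trans b≡2+d+a (cong suc (trans (sym (ℕₚ.+-suc d (toℕ a))) (cong (d +_) (sym a′≡1+a))))
  a≢a′ : a ≢ a′
  a≢a′ a≡a′ = ℕₚ.1+n≢n (sym (trans (cong toℕ a≡a′) a′≡1+a))
  a≢b : a ≢ b
  a≢b a≡b = ℕₚ.<-irrefl (cong toℕ a≡b) (ℕₚ.<-trans (ℕₚ.n<1+n (toℕ a)) 1+a<b)
  a′≢b : a′ ≢ b
  a′≢b a′≡b = ℕₚ.<-irrefl (trans (sym a′≡1+a) (cong toℕ a′≡b)) 1+a<b

isOdd-∘-transpose : ∀ {n} (g : Permutation′ n) {a b : Fin n} → a ≢ b → isOdd (g ∘ₚ transpose a b) ≡ not (isOdd g)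
isOdd-∘-transpose g {a} {b} a≢b with Finₚ.<-cmp a b
... | tri< a<b _ _ = isOdd-∘-transpose-at-distance _ g (n≡1+[n∸1+m]+m a<b)
... | tri≈ _ a≡b _ = ⊥-elim (a≢b a≡b)
... | tri> _ _ b<a = trans (inversionParity-cong (transpose-comm a b ∘ (g ⟨$⟩ʳ_)))
                           (isOdd-∘-transpose-at-distance _ g (n≡1+[n∸1+m]+m b<a))

InG⊎InG∘transpose : ∀ {n} (w : Which) (g : Permutation′ n) {c d : Fin n} → c ≢ d →
  InG w g ⊎ InG w (g ∘ₚ transpose c d)
InG⊎InG∘transpose Sym g c≢d = inj₁ _
InG⊎InG∘transpose Alt g {c} {d} c≢d with isOdd g in g-odd
... | false = inj₁ (parity≡false⇒%2≡0 (inversions g) (trans (parity-inversions g) g-odd))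
... | true  = inj₂ (parity≡false⇒%2≡0 (inversions (g ∘ₚ transpose c d)) (begin
  parity (inversions (g ∘ₚ transpose c d)) ≡⟨ parity-inversions (g ∘ₚ transpose c d) ⟩
  isOdd (g ∘ₚ transpose c d)                ≡⟨ isOdd-∘-transpose g c≢d ⟩
  not (isOdd g)                             ≡⟨ cong not g-odd ⟩
  false                                     ∎))
  where open ≡-Reasoning

-- Images of subsets under permutations

lookup-image : ∀ {n} (g : Permutation′ n) (S : Subset n) x → lookup (image g S) x ≡ lookup S (g ⟨$⟩ˡ x)
lookup-image g S = Vecₚ.lookup∘tabulate _

image-≡ : ∀ {n} (g : Permutation′ n) (S : Subset n) {T} → (∀ x → lookup S (g ⟨$⟩ˡ x) ≡ lookup T x) → image g S ≡ T
image-≡ g S {T} e = trans (Vecₚ.tabulate-cong e) (Vecₚ.tabulate∘lookup T)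

image-∘ : ∀ {n} (g h : Permutation′ n) S → image (g ∘ₚ h) S ≡ image h (image g S)
image-∘ g h S = image-≡ (g ∘ₚ h) S λ x → sym (trans (lookup-image h (image g S) x) (lookup-image g S _))

image-flip : ∀ {n} (g : Permutation′ n) S → image (Perm.flip g) (image g S) ≡ S
image-flip g S = image-≡ (Perm.flip g) (image g S) λ x → trans (lookup-image g S _) (cong (lookup S) (Perm.inverseˡ g))

∈-image⁺ : ∀ {n} (g : Permutation′ n) {S x} → x ∈ S → g ⟨$⟩ʳ x ∈ image g S
∈-image⁺ g {S} {x} x∈S = Vecₚ.lookup⇒[]= _ _
  (trans (lookup-image g S (g ⟨$⟩ʳ x)) (trans (cong (lookup S) (Perm.inverseˡ g)) (Vecₚ.[]=⇒lookup x∈S)))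

∈-image⁻ : ∀ {n} (g : Permutation′ n) {S x} → x ∈ image g S → g ⟨$⟩ˡ x ∈ S
∈-image⁻ g {S} {x} x∈gS = Vecₚ.lookup⇒[]= _ _ (trans (sym (lookup-image g S x)) (Vecₚ.[]=⇒lookup x∈gS))

image-⊆ : ∀ {n} (g : Permutation′ n) {S T} → S ⊆ T → image g S ⊆ image g T
image-⊆ g {S} {T} S⊆T {x} x∈gS = subst (_∈ image g T) (Perm.inverseʳ g) (∈-image⁺ g (S⊆T (∈-image⁻ g x∈gS)))

∉⇒lookup≡outside : ∀ {n} {x : Fin n} {p} → x ∉ p → lookup p x ≡ outside
∉⇒lookup≡outside {x = x} {p} x∉p with lookup p x in e
... | true  = ⊥-elim (x∉p (Vecₚ.lookup⇒[]= x p e))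
... | false = refl

∈⇒lookup≡∈ : ∀ {n} {x y : Fin n} {p} → x ∈ p → y ∈ p → lookup p x ≡ lookup p y
∈⇒lookup≡∈ x∈p y∈p = trans (Vecₚ.[]=⇒lookup x∈p) (sym (Vecₚ.[]=⇒lookup y∈p))

∉⇒lookup≡∉ : ∀ {n} {x y : Fin n} {p} → x ∉ p → y ∉ p → lookup p x ≡ lookup p y
∉⇒lookup≡∉ x∉p y∉p = trans (∉⇒lookup≡outside x∉p) (sym (∉⇒lookup≡outside y∉p))

image-transpose-fixed : ∀ {n} {c d : Fin n} {T} → lookup T c ≡ lookup T d → image (transpose c d) T ≡ T
image-transpose-fixed {c = c} {d} {T} Tc≡Td = image-≡ (transpose c d) T λ x → cases x (x ≟ d) (x ≟ c)
  where
  cases : ∀ x → Dec (x ≡ d) → Dec (x ≡ c) → lookup T (PC.transpose d c x) ≡ lookup T x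
  cases x (yes refl) _      rewrite transpose-≡ˡ x c = Tc≡Td
  cases x (no _) (yes refl) rewrite transpose-≡ʳ d x = sym Tc≡Td
  cases x (no x≢d) (no x≢c) rewrite transpose-≢ x≢d x≢c = refl

∣p∣≡count : ∀ {n} (p : Subset n) → ∣ p ∣ ≡ count (lookup p)
∣p∣≡count []          = refl
∣p∣≡count (true ∷ p)  = cong suc (∣p∣≡count p)
∣p∣≡count (false ∷ p) = ∣p∣≡count p

∣image∣ : ∀ {n} (g : Permutation′ n) S → ∣ image g S ∣ ≡ ∣ S ∣
∣image∣ g S = begin
  ∣ image g S ∣                     ≡⟨ ∣p∣≡count (image g S) ⟩
  count (lookup (image g S))         ≡⟨ ℕ-sum-cong (cong indicator ∘ lookup-image g S) ⟩
  count (lookup S ∘ (g ⟨$⟩ˡ_))        ≡⟨ sym (ℕ-sum-permute (indicator ∘ lookup S) (Perm.flip g)) ⟩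
  count (lookup S)                   ≡⟨ sym (∣p∣≡count S) ⟩
  ∣ S ∣                              ∎
  where open ≡-Reasoning

initial : ∀ {n} → ℕ → Subset n
initial {zero}  _       = []
initial {suc n} zero    = outside ∷ initial zero
initial {suc n} (suc k) = inside ∷ initial k

lookup-initial : ∀ {n} k (x : Fin n) → lookup (initial k) x ≡ ⌊ toℕ x ℕ.<? k ⌋
lookup-initial zero    zero    = refl
lookup-initial (suc k) zero    = refl
lookup-initial zero    (suc x) = lookup-initial zero x
lookup-initial (suc k) (suc x) =
  trans (lookup-initial k x) (isYes-⇔ (mk⇔ s≤s ℕₚ.≤-pred) (toℕ x ℕ.<? k) (suc (toℕ x) ℕ.<? suc k))

∣initial∣ : ∀ {n} k → k ≤ n → ∣ initial {n} k ∣ ≡ k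
∣initial∣ {zero}  zero    _           = refl
∣initial∣ {suc n} zero    _           = ∣initial∣ {n} zero z≤n
∣initial∣ {suc n} (suc k) (s≤s k≤n) = cong suc (∣initial∣ k k≤n)

initial-shift : ∀ {n} k (k≤n : k ≤ n) →
  image (transpose zero (Fin.fromℕ< (s≤s k≤n))) (initial {suc n} k) ≡ outside ∷ initial {n} k
initial-shift {n} k k≤n = image-≡ (transpose zero kF) (initial k) λ where
    zero → begin
      lookup (initial k) (PC.transpose kF zero zero) ≡⟨ cong (lookup (initial k)) (transpose-≡ʳ kF zero) ⟩
      lookup (initial k) kF                           ≡⟨ lookup-initial k kF ⟩
      ⌊ toℕ kF ℕ.<? k ⌋                               ≡⟨ isYes-false (toℕ kF ℕ.<? k) (ℕₚ.<-irrefl kF≡k) ⟩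
      false                                           ∎
    (suc y) → shifted y (suc y ≟ kF)
  where
  open ≡-Reasoning
  kF : Fin (suc n)
  kF = Fin.fromℕ< (s≤s k≤n)
  kF≡k : toℕ kF ≡ k
  kF≡k = Finₚ.toℕ-fromℕ< (s≤s k≤n)
  shifted : ∀ y → Dec (suc y ≡ kF) → lookup (initial k) (PC.transpose kF zero (suc y)) ≡ lookup (initial {n} k) y
  shifted y (yes 1+y≡kF) = begin
    lookup (initial k) (PC.transpose kF zero (suc y))
      ≡⟨ cong (lookup (initial k) ∘ PC.transpose kF zero) 1+y≡kF ⟩
    lookup (initial k) (PC.transpose kF zero kF)
      ≡⟨ cong (lookup (initial k)) (transpose-≡ˡ kF zero) ⟩
    lookup (initial k) zero
      ≡⟨ lookup-initial k zero ⟩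
    ⌊ 0 ℕ.<? k ⌋
      ≡⟨ isYes-true (0 ℕ.<? k) (subst (0 <_) 1+y≡k (s≤s z≤n)) ⟩
    true
      ≡⟨ sym (isYes-true (toℕ y ℕ.<? k) (subst (toℕ y <_) 1+y≡k (ℕₚ.n<1+n _))) ⟩
    ⌊ toℕ y ℕ.<? k ⌋
      ≡⟨ sym (lookup-initial k y) ⟩
    lookup (initial k) y ∎
    where
    1+y≡k : suc (toℕ y) ≡ k
    1+y≡k = trans (cong toℕ 1+y≡kF) kF≡k
  shifted y (no 1+y≢kF) = begin
    lookup (initial k) (PC.transpose kF zero (suc y)) ≡⟨ cong (lookup (initial k)) (transpose-≢ 1+y≢kF (λ ())) ⟩
    lookup (initial k) (suc y)                         ≡⟨ lookup-initial k (suc y) ⟩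
    ⌊ suc (toℕ y) ℕ.<? k ⌋                             ≡⟨ isYes-⇔ (mk⇔ (ℕₚ.<-trans (ℕₚ.n<1+n _)) 1+y<k) _ _ ⟩
    ⌊ toℕ y ℕ.<? k ⌋                                   ≡⟨ sym (lookup-initial k y) ⟩
    lookup (initial k) y                               ∎
    where
    1+y<k : toℕ y < k → suc (toℕ y) < k
    1+y<k y<k = ℕₚ.≤∧≢⇒< y<k (1+y≢kF ∘ Finₚ.toℕ-injective ∘ flip trans (sym kF≡k))

image-initial : ∀ {n} (S : Subset n) → ∃ λ π → image π (initial ∣ S ∣) ≡ S
image-initial []         = Perm.id , refl
image-initial (true ∷ S) with image-initial S
... | π , πS = Perm.lift₀ π , cong (inside ∷_) πS
image-initial {suc n} (false ∷ S) with image-initial S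
... | π , πS = shift ∘ₚ Perm.lift₀ π , (begin
  image (shift ∘ₚ Perm.lift₀ π) (initial ∣ S ∣)
    ≡⟨ image-∘ shift (Perm.lift₀ π) (initial ∣ S ∣) ⟩
  image (Perm.lift₀ π) (image shift (initial ∣ S ∣))
    ≡⟨ cong (image (Perm.lift₀ π)) (initial-shift ∣ S ∣ (Subsetₚ.∣p∣≤n S)) ⟩
  outside ∷ image π (initial ∣ S ∣)
    ≡⟨ cong (outside ∷_) πS ⟩
  false ∷ S ∎)
  where
  open ≡-Reasoning
  shift : Permutation′ (suc n)
  shift = transpose zero (Fin.fromℕ< (s≤s (Subsetₚ.∣p∣≤n S)))

image-≡-of-∣∣≡ : ∀ {n} {S T : Subset n} → ∣ S ∣ ≡ ∣ T ∣ → ∃ λ g → image g S ≡ T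
image-≡-of-∣∣≡ {S = S} {T} ∣S∣≡∣T∣ with image-initial S | image-initial T
... | πS , πS-S | πT , πT-T = Perm.flip πS ∘ₚ πT , (begin
  image (Perm.flip πS ∘ₚ πT) S                  ≡⟨ image-∘ (Perm.flip πS) πT S ⟩
  image πT (image (Perm.flip πS) S)             ≡⟨ cong (image πT ∘ image (Perm.flip πS)) (sym πS-S) ⟩
  image πT (image (Perm.flip πS) (image πS (initial ∣ S ∣)))  ≡⟨ cong (image πT) (image-flip πS (initial ∣ S ∣)) ⟩
  image πT (initial ∣ S ∣)                      ≡⟨ cong (image πT ∘ initial) ∣S∣≡∣T∣ ⟩
  image πT (initial ∣ T ∣)                      ≡⟨ πT-T ⟩
  T                                             ∎)
  where open ≡-Reasoning

-- Flag-transitivity and primitivity of S_n and A_n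

nonempty : ∀ {n} {p : Subset n} → 1 ≤ ∣ p ∣ → Nonempty p
nonempty {p = inside  ∷ p} _  = zero , here
nonempty {p = outside ∷ p} 1≤∣p∣ with nonempty 1≤∣p∣
... | x , x∈p = suc x , there x∈p

twoElements : ∀ {n} {p : Subset n} → 2 ≤ ∣ p ∣ → ∃₂ λ x y → x ≢ y × x ∈ p × y ∈ p
twoElements {p = inside ∷ p} (s≤s 1≤∣p∣) with nonempty 1≤∣p∣
... | y , y∈p = zero , suc y , (λ ()) , here , there y∈p
twoElements {p = outside ∷ p} 2≤∣p∣ with twoElements 2≤∣p∣
... | x , y , x≢y , x∈p , y∈p = suc x , suc y , x≢y ∘ Finₚ.suc-injective , there x∈p , there y∈p

twoOutside : ∀ {n} {p : Subset n} → 2 + ∣ p ∣ ≤ n → ∃₂ λ x y → x ≢ y × x ∉ p × y ∉ p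
twoOutside {n} {p} room with twoElements {p = ∁ p} (subst (2 ≤_) (sym (Subsetₚ.∣∁p∣≡n∸∣p∣ p)) (ℕₚ.m+n≤o⇒m≤o∸n 2 room))
... | x , y , x≢y , x∈∁p , y∈∁p = x , y , x≢y , Subsetₚ.x∈∁p⇒x∉p x∈∁p , Subsetₚ.x∈∁p⇒x∉p y∈∁p

flagTransitive-Sym : ∀ {n} {S T : Subset n} → ∣ S ∣ ≡ ∣ T ∣ → ∀ {α β} → α ∈ S → β ∈ T →
  ∃ λ g → g ⟨$⟩ʳ α ≡ β × image g S ≡ T
flagTransitive-Sym {S = S} {T} ∣S∣≡∣T∣ {α} {β} α∈S β∈T with image-≡-of-∣∣≡ {S = S} {T} ∣S∣≡∣T∣
... | g , gS≡T = g ∘ₚ transpose (g ⟨$⟩ʳ α) β , transpose-≡ˡ (g ⟨$⟩ʳ α) β , (begin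
  image (g ∘ₚ transpose (g ⟨$⟩ʳ α) β) S      ≡⟨ image-∘ g (transpose (g ⟨$⟩ʳ α) β) S ⟩
  image (transpose (g ⟨$⟩ʳ α) β) (image g S) ≡⟨ cong (image (transpose (g ⟨$⟩ʳ α) β)) gS≡T ⟩
  image (transpose (g ⟨$⟩ʳ α) β) T           ≡⟨ image-transpose-fixed {T = T} (∈⇒lookup≡∈ gα∈T β∈T) ⟩
  T                                          ∎)
  where
  open ≡-Reasoning
  gα∈T : g ⟨$⟩ʳ α ∈ T
  gα∈T = subst (g ⟨$⟩ʳ α ∈_) gS≡T (∈-image⁺ g α∈S)

-- A transposition of two points outside T corrects the parity without disturbing the flag.
flagTransitive : ∀ {n} (w : Which) {S T : Subset n} → ∣ S ∣ ≡ ∣ T ∣ → 2 + ∣ T ∣ ≤ n → ∀ {α β} → α ∈ S → β ∈ T →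
  ∃ λ g → InG w g × g ⟨$⟩ʳ α ≡ β × image g S ≡ T
flagTransitive w {S} {T} ∣S∣≡∣T∣ room {α} {β} α∈S β∈T
  with flagTransitive-Sym {S = S} {T} ∣S∣≡∣T∣ α∈S β∈T | twoOutside {p = T} room
... | g , gα≡β , gS≡T | c , d , c≢d , c∉T , d∉T with InG⊎InG∘transpose w g c≢d
...   | inj₁ g∈G  = g , g∈G , gα≡β , gS≡T
...   | inj₂ gτ∈G = g ∘ₚ transpose c d , gτ∈G ,
  trans (cong (PC.transpose c d) gα≡β) (transpose-≢ (c∉T ∘ β≡⇒∈T) (d∉T ∘ β≡⇒∈T)) ,
  trans (image-∘ g (transpose c d) S)
        (trans (cong (image (transpose c d)) gS≡T) (image-transpose-fixed {T = T} (∉⇒lookup≡∉ c∉T d∉T)))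
  where
  β≡⇒∈T : ∀ {x} → β ≡ x → x ∈ T
  β≡⇒∈T β≡x = subst (_∈ T) β≡x β∈T

∣⁅x⁆∪⁅y⁆∣≡2 : ∀ {n} {x y : Fin n} → x ≢ y → ∣ ⁅ x ⁆ ∪ ⁅ y ⁆ ∣ ≡ 2
∣⁅x⁆∪⁅y⁆∣≡2 {x = zero}  {zero}  x≢y = ⊥-elim (x≢y refl)
∣⁅x⁆∪⁅y⁆∣≡2 {x = zero}  {suc y} _   = cong suc (trans (cong ∣_∣ (Subsetₚ.∪-identityˡ ⁅ y ⁆)) (Subsetₚ.∣⁅x⁆∣≡1 y))
∣⁅x⁆∪⁅y⁆∣≡2 {x = suc x} {zero}  _   = cong suc (trans (cong ∣_∣ (Subsetₚ.∪-identityʳ ⁅ x ⁆)) (Subsetₚ.∣⁅x⁆∣≡1 x))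
∣⁅x⁆∪⁅y⁆∣≡2 {x = suc x} {suc y} x≢y = ∣⁅x⁆∪⁅y⁆∣≡2 (x≢y ∘ cong suc)

⁅x⁆∪⁅y⁆⊆p : ∀ {n} {x y : Fin n} {p} → x ∈ p → y ∈ p → ⁅ x ⁆ ∪ ⁅ y ⁆ ⊆ p
⁅x⁆∪⁅y⁆⊆p {x = x} {y} {p} x∈p y∈p {z} z∈xy with Subsetₚ.x∈p∪q⁻ ⁅ x ⁆ ⁅ y ⁆ z∈xy
... | inj₁ z∈⁅x⁆ = subst (_∈ p) (sym (Subsetₚ.x∈⁅y⁆⇒x≡y x z∈⁅x⁆)) x∈p
... | inj₂ z∈⁅y⁆ = subst (_∈ p) (sym (Subsetₚ.x∈⁅y⁆⇒x≡y y z∈⁅y⁆)) y∈p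

InG-transitive : ∀ {n} (w : Which) → 3 ≤ n → Transitive {n} (InG w)
InG-transitive {n} w 3≤n α β
  with flagTransitive w {⁅ α ⁆} {⁅ β ⁆} ∣⁅α⁆∣≡∣⁅β⁆∣ room (Subsetₚ.x∈⁅x⁆ α) (Subsetₚ.x∈⁅x⁆ β)
  where
  ∣⁅α⁆∣≡∣⁅β⁆∣ : ∣ ⁅ α ⁆ ∣ ≡ ∣ ⁅ β ⁆ ∣
  ∣⁅α⁆∣≡∣⁅β⁆∣ = trans (Subsetₚ.∣⁅x⁆∣≡1 α) (sym (Subsetₚ.∣⁅x⁆∣≡1 β))
  room : 2 + ∣ ⁅ β ⁆ ∣ ≤ n
  room = subst (λ k → 2 + k ≤ n) (sym (Subsetₚ.∣⁅x⁆∣≡1 β)) 3≤n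
... | g , g∈G , gα≡β , _ = g , g∈G , gα≡β

-- An even permutation fixing a and carrying {a, b} ⊆ Δ onto {a, c} moves Δ onto a set that
-- meets Δ in a and contains c ∉ Δ.
proper-block-impossible : ∀ {n} (w : Which) → 4 ≤ n → ∀ {Δ} → IsBlockOfImprimitivity (InG w) Δ →
  ∀ {a b c} → a ≢ b → a ∈ Δ → b ∈ Δ → c ∉ Δ → ⊥
proper-block-impossible {n} w 4≤n {Δ} block {a} {b} {c} a≢b a∈Δ b∈Δ c∉Δ
  with flagTransitive w {⁅ a ⁆ ∪ ⁅ b ⁆} {⁅ a ⁆ ∪ ⁅ c ⁆} ∣S∣≡∣T∣ room a∈S a∈T
  where
  a∈S : a ∈ ⁅ a ⁆ ∪ ⁅ b ⁆
  a∈S = Subsetₚ.x∈p∪q⁺ (inj₁ (Subsetₚ.x∈⁅x⁆ a))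
  a∈T : a ∈ ⁅ a ⁆ ∪ ⁅ c ⁆
  a∈T = Subsetₚ.x∈p∪q⁺ (inj₁ (Subsetₚ.x∈⁅x⁆ a))
  a≢c : a ≢ c
  a≢c a≡c = c∉Δ (subst (_∈ Δ) a≡c a∈Δ)
  ∣S∣≡∣T∣ : ∣ ⁅ a ⁆ ∪ ⁅ b ⁆ ∣ ≡ ∣ ⁅ a ⁆ ∪ ⁅ c ⁆ ∣
  ∣S∣≡∣T∣ = trans (∣⁅x⁆∪⁅y⁆∣≡2 a≢b) (sym (∣⁅x⁆∪⁅y⁆∣≡2 a≢c))
  room : 2 + ∣ ⁅ a ⁆ ∪ ⁅ c ⁆ ∣ ≤ n
  room = subst (λ k → 2 + k ≤ n) (sym (∣⁅x⁆∪⁅y⁆∣≡2 a≢c)) 4≤n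
... | g , g∈G , ga≡a , gS≡T with block g g∈G
...   | inj₁ gΔ≡Δ = c∉Δ (subst (c ∈_) gΔ≡Δ c∈gΔ)
  where
  c∈gΔ : c ∈ image g Δ
  c∈gΔ = image-⊆ g (⁅x⁆∪⁅y⁆⊆p a∈Δ b∈Δ) (subst (c ∈_) (sym gS≡T) (Subsetₚ.x∈p∪q⁺ (inj₂ (Subsetₚ.x∈⁅x⁆ c))))
...   | inj₂ gΔ∩Δ-empty = gΔ∩Δ-empty (a , Subsetₚ.x∈p∩q⁺ (subst (_∈ image g Δ) ga≡a (∈-image⁺ g a∈Δ) , a∈Δ))

InG-primitive : ∀ {n} (w : Which) → 4 ≤ n → Primitive {n} (InG w)
InG-primitive {n} w 4≤n = InG-transitive w (ℕₚ.≤-trans (ℕₚ.n≤1+n 3) 4≤n) , blocks-trivial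
  where
  blocks-trivial : ∀ Δ → IsBlockOfImprimitivity (InG w) Δ → ∣ Δ ∣ ≤ 1 ⊎ Δ ≡ ⊤
  blocks-trivial Δ block with ∣ Δ ∣ ℕ.≤? 1 | ∣ Δ ∣ ℕ.≟ n
  ... | yes ∣Δ∣≤1 | _        = inj₁ ∣Δ∣≤1
  ... | no _      | yes ∣Δ∣≡n = inj₂ (Subsetₚ.∣p∣≡n⇒p≡⊤ ∣Δ∣≡n)
  ... | no ∣Δ∣≰1  | no ∣Δ∣≢n
    with twoElements (ℕₚ.≰⇒> ∣Δ∣≰1)
       | nonempty {p = ∁ Δ} (subst (1 ≤_) (sym (Subsetₚ.∣∁p∣≡n∸∣p∣ Δ)) (ℕₚ.m<n⇒0<n∸m ∣Δ∣<n))
    where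
    ∣Δ∣<n : ∣ Δ ∣ < n
    ∣Δ∣<n = ℕₚ.≤∧≢⇒< (Subsetₚ.∣p∣≤n Δ) ∣Δ∣≢n
  ...   | a , b , a≢b , a∈Δ , b∈Δ | c , c∈∁Δ =
    ⊥-elim (proper-block-impossible w 4≤n block a≢b a∈Δ b∈Δ (Subsetₚ.x∈∁p⇒x∉p c∈∁Δ))

-- Counting subsets

module _ {A : Set} where

  length-filterᵇ-++ : ∀ (p : A → Bool) xs ys →
    List.length (filterᵇ p (xs List.++ ys)) ≡ List.length (filterᵇ p xs) + List.length (filterᵇ p ys)
  length-filterᵇ-++ p xs ys = trans (cong List.length (Listₚ.filter-++ (T? ∘ p) xs ys)) (Listₚ.length-++ (filterᵇ p xs))

  filterᵇ-map : ∀ {B : Set} (p : B → Bool) (f : A → B) xs → filterᵇ p (List.map f xs) ≡ List.map f (filterᵇ (p ∘ f) xs)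
  filterᵇ-map p f []       = refl
  filterᵇ-map p f (x ∷ xs) with p (f x)
  ... | true  = cong (f x ∷_) (filterᵇ-map p f xs)
  ... | false = filterᵇ-map p f xs

  filterᵇ-cong : ∀ {p q : A → Bool} → (∀ x → p x ≡ q x) → ∀ xs → filterᵇ p xs ≡ filterᵇ q xs
  filterᵇ-cong {p} {q} p≗q []       = refl
  filterᵇ-cong {p} {q} p≗q (x ∷ xs) with p x | q x | p≗q x
  ... | true  | true  | refl = cong (x ∷_) (filterᵇ-cong p≗q xs)
  ... | false | false | refl = filterᵇ-cong p≗q xs

  filterᵇ-false : ∀ xs → filterᵇ {A = A} (λ _ → false) xs ≡ []
  filterᵇ-false []       = refl
  filterᵇ-false (_ ∷ xs) = filterᵇ-false xs

  filterᵇ-nonempty : ∀ (p : A → Bool) xs → 1 ≤ List.length (filterᵇ p xs) → ∃ λ x → p x ≡ true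
  filterᵇ-nonempty p (x ∷ xs) 1≤len with p x in px
  ... | true  = x , px
  ... | false = filterᵇ-nonempty p xs 1≤len

countSubsets-split : ∀ {n} (P : Subset (suc n) → Bool) →
  countSubsets P ≡ countSubsets (P ∘ (inside ∷_)) + countSubsets (P ∘ (outside ∷_))
countSubsets-split {n} P = begin
  countSubsets P
    ≡⟨ length-filterᵇ-++ P (List.map (inside ∷_) (allSubsets n)) (List.map (outside ∷_) (allSubsets n)) ⟩
  List.length (filterᵇ P (List.map (inside ∷_) (allSubsets n))) +
  List.length (filterᵇ P (List.map (outside ∷_) (allSubsets n)))
    ≡⟨ cong₂ _+_ (length-filterᵇ-map (inside ∷_)) (length-filterᵇ-map (outside ∷_)) ⟩
  countSubsets (P ∘ (inside ∷_)) + countSubsets (P ∘ (outside ∷_)) ∎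
  where
  open ≡-Reasoning
  length-filterᵇ-map : ∀ f → List.length (filterᵇ P (List.map f (allSubsets n))) ≡ countSubsets (P ∘ f)
  length-filterᵇ-map f =
    trans (cong List.length (filterᵇ-map P f (allSubsets n))) (Listₚ.length-map f (filterᵇ (P ∘ f) (allSubsets n)))

countSubsets-cong : ∀ {n} {P Q : Subset n → Bool} → (∀ S → P S ≡ Q S) → countSubsets P ≡ countSubsets Q
countSubsets-cong {n} P≗Q = cong List.length (filterᵇ-cong P≗Q (allSubsets n))

countSubsets-false : ∀ {n} (P : Subset n → Bool) → (∀ S → P S ≡ false) → countSubsets P ≡ 0
countSubsets-false {n} P P≗false = trans (countSubsets-cong P≗false) (cong List.length (filterᵇ-false (allSubsets n)))

countSubsets-nonempty : ∀ {n} (P : Subset n → Bool) → 1 ≤ countSubsets P → ∃ λ S → P S ≡ true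
countSubsets-nonempty {n} P = filterᵇ-nonempty P (allSubsets n)

fullDesign-≡true : ∀ {n} k (S : Subset n) → fullDesign n k S ≡ true ⇔ ∣ S ∣ ≡ k
fullDesign-≡true k S = mk⇔ (ℕₚ.≡ᵇ⇒≡ ∣ S ∣ k ∘ Equivalence.from Boolₚ.T-≡) (Equivalence.to Boolₚ.T-≡ ∘ ℕₚ.≡⇒≡ᵇ ∣ S ∣ k)

∈⇒1≤∣p∣ : ∀ {n} {x : Fin n} {p} → x ∈ p → 1 ≤ ∣ p ∣
∈⇒1≤∣p∣ x∈p = ℕₚ.≤-trans (s≤s z≤n) (Subsetₚ.x∈p⇒∣p-x∣<∣p∣ x∈p)

∈∈⇒2≤∣p∣ : ∀ {n} {x y : Fin n} {p} → x ≢ y → x ∈ p → y ∈ p → 2 ≤ ∣ p ∣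
∈∈⇒2≤∣p∣ x≢y x∈p y∈p =
  ℕₚ.≤-trans (s≤s (∈⇒1≤∣p∣ (Subsetₚ.x∈p∧x≢y⇒x∈p-y y∈p (x≢y ∘ sym)))) (Subsetₚ.x∈p⇒∣p-x∣<∣p∣ x∈p)

has⇒∈ : ∀ {n} {x : Fin n} {S} → has x S ≡ true → x ∈ S
has⇒∈ = Vecₚ.lookup⇒[]= _ _

C-positive : ∀ {n k} → k ≤ n → 1 ≤ n C k
C-positive {n}     {zero}  _           = s≤s z≤n
C-positive {suc n} {suc k} (s≤s k≤n) =
  ℕₚ.≤-trans (C-positive k≤n) (ℕₚ.≤-trans (ℕₚ.m≤m+n (n C k) (n C suc k)) (ℕₚ.≤-reflexive (nCk+nC[k+1]≡[n+1]C[k+1] n k)))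

countSubsets-fullDesign : ∀ n k → countSubsets (fullDesign n k) ≡ n C k
countSubsets-fullDesign zero    zero    = refl
countSubsets-fullDesign zero    (suc k) = refl
countSubsets-fullDesign (suc n) zero    =
  trans (countSubsets-split (fullDesign (suc n) 0))
        (cong₂ _+_ (countSubsets-false (fullDesign (suc n) 0 ∘ (inside ∷_)) (λ _ → refl)) (countSubsets-fullDesign n 0))
countSubsets-fullDesign (suc n) (suc k) =
  trans (countSubsets-split (fullDesign (suc n) (suc k)))
        (trans (cong₂ _+_ (countSubsets-fullDesign n k) (countSubsets-fullDesign n (suc k))) (nCk+nC[k+1]≡[n+1]C[k+1] n k))

countSubsets-fullDesign-∋ : ∀ n k (x : Fin (suc n)) →
  countSubsets (λ S → fullDesign (suc n) (suc k) S ∧ has x S) ≡ n C k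
countSubsets-fullDesign-∋ n k zero = begin
  countSubsets (λ S → fullDesign (suc n) (suc k) S ∧ has zero S)
    ≡⟨ countSubsets-split (λ S → fullDesign (suc n) (suc k) S ∧ has zero S) ⟩
  countSubsets (λ S → fullDesign n k S ∧ true) +
  countSubsets (λ S → fullDesign (suc n) (suc k) (outside ∷ S) ∧ false)
    ≡⟨ cong₂ _+_ (countSubsets-cong (λ S → Boolₚ.∧-identityʳ (fullDesign n k S)))
                 (countSubsets-false (λ S → fullDesign (suc n) (suc k) (outside ∷ S) ∧ false) (λ S → Boolₚ.∧-zeroʳ _)) ⟩
  countSubsets (fullDesign n k) + 0 ≡⟨ ℕₚ.+-identityʳ _ ⟩
  countSubsets (fullDesign n k)     ≡⟨ countSubsets-fullDesign n k ⟩
  n C k                             ∎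
  where open ≡-Reasoning
countSubsets-fullDesign-∋ (suc n) zero (suc x) =
  trans (countSubsets-split (λ S → fullDesign (2 + n) 1 S ∧ has (suc x) S))
        (cong₂ _+_ (countSubsets-false (λ S → fullDesign (suc n) 0 S ∧ has x S) empty-∌) (countSubsets-fullDesign-∋ n 0 x))
  where
  empty-∌ : ∀ S → fullDesign (suc n) 0 S ∧ has x S ≡ false
  empty-∌ S = Boolₚ.¬-not λ e →
    ℕₚ.<-irrefl (sym (Equivalence.to (fullDesign-≡true 0 S) (Boolₚ.∧-conicalˡ _ (has x S) e)))
                (∈⇒1≤∣p∣ {p = S} (has⇒∈ (Boolₚ.∧-conicalʳ (fullDesign (suc n) 0 S) _ e)))
countSubsets-fullDesign-∋ (suc n) (suc k) (suc x) =
  trans (countSubsets-split (λ S → fullDesign (2 + n) (2 + k) S ∧ has (suc x) S))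
        (trans (cong₂ _+_ (countSubsets-fullDesign-∋ n k x) (countSubsets-fullDesign-∋ n (suc k) x))
               (nCk+nC[k+1]≡[n+1]C[k+1] n k))

countSubsets-fullDesign-∋∋ : ∀ n k {x y : Fin (2 + n)} → x ≢ y →
  countSubsets (λ S → fullDesign (2 + n) (2 + k) S ∧ has x S ∧ has y S) ≡ n C k
countSubsets-fullDesign-∋∋ n k {zero} {zero} x≢y = ⊥-elim (x≢y refl)
countSubsets-fullDesign-∋∋ n k {zero} {suc y} _ = begin
  countSubsets (λ S → fullDesign (2 + n) (2 + k) S ∧ has zero S ∧ has (suc y) S)
    ≡⟨ countSubsets-split (λ S → fullDesign (2 + n) (2 + k) S ∧ has zero S ∧ has (suc y) S) ⟩
  countSubsets (λ S → fullDesign (suc n) (suc k) S ∧ has y S) +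
  countSubsets (λ S → fullDesign (2 + n) (2 + k) (outside ∷ S) ∧ false)
    ≡⟨ cong₂ _+_ (countSubsets-fullDesign-∋ n k y)
                 (countSubsets-false (λ S → fullDesign (2 + n) (2 + k) (outside ∷ S) ∧ false) (λ S → Boolₚ.∧-zeroʳ _)) ⟩
  n C k + 0 ≡⟨ ℕₚ.+-identityʳ _ ⟩
  n C k     ∎
  where open ≡-Reasoning
countSubsets-fullDesign-∋∋ n k {suc x} {zero} _ =
  trans (countSubsets-cong λ S → cong (fullDesign (2 + n) (2 + k) S ∧_) (Boolₚ.∧-comm (has (suc x) S) (has zero S)))
        (countSubsets-fullDesign-∋∋ n k {zero} {suc x} (λ ()))
countSubsets-fullDesign-∋∋ zero k {suc zero} {suc zero} x≢y = ⊥-elim (x≢y refl)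
countSubsets-fullDesign-∋∋ (suc n) zero {suc x} {suc y} x≢y =
  trans (countSubsets-split (λ S → fullDesign (3 + n) 2 S ∧ has (suc x) S ∧ has (suc y) S))
        (cong₂ _+_ (countSubsets-false (λ S → fullDesign (2 + n) 1 S ∧ has x S ∧ has y S) singleton-∌∌)
                   (countSubsets-fullDesign-∋∋ n zero (x≢y ∘ cong suc)))
  where
  singleton-∌∌ : ∀ S → fullDesign (2 + n) 1 S ∧ has x S ∧ has y S ≡ false
  singleton-∌∌ S = Boolₚ.¬-not λ e →
    let x∈S∧y∈S = Boolₚ.∧-conicalʳ (fullDesign (2 + n) 1 S) (has x S ∧ has y S) e in
    ℕₚ.<-irrefl (sym (Equivalence.to (fullDesign-≡true 1 S) (Boolₚ.∧-conicalˡ _ (has x S ∧ has y S) e)))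
                (∈∈⇒2≤∣p∣ {p = S} (x≢y ∘ cong suc) (has⇒∈ (Boolₚ.∧-conicalˡ _ (has y S) x∈S∧y∈S))
                                                   (has⇒∈ (Boolₚ.∧-conicalʳ (has x S) _ x∈S∧y∈S)))
countSubsets-fullDesign-∋∋ (suc n) (suc k) {suc x} {suc y} x≢y =
  trans (countSubsets-split (λ S → fullDesign (3 + n) (3 + k) S ∧ has (suc x) S ∧ has (suc y) S))
        (trans (cong₂ _+_ (countSubsets-fullDesign-∋∋ n k x≢y′) (countSubsets-fullDesign-∋∋ n (suc k) x≢y′))
               (nCk+nC[k+1]≡[n+1]C[k+1] n k))
  where
  x≢y′ : x ≢ y
  x≢y′ = x≢y ∘ cong suc

fullDesign-Is2Design : ∀ m k → k ≤ m → Is2Design (2 + m) (fullDesign (2 + m) (2 + k)) (2 + k) (m C k)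
fullDesign-Is2Design m k k≤m =
  (λ S → Equivalence.to (fullDesign-≡true (2 + k) S)) ,
  (λ x y x≢y → countSubsets-fullDesign-∋∋ m k x≢y) ,
  C-positive k≤m

fullDesign-IsAutGroup : ∀ {n} (G : Group′ n) k → IsAutGroup G (fullDesign n k)
fullDesign-IsAutGroup G k g _ S S∈B = trans (cong (_≡ᵇ k) (∣image∣ g S)) S∈B

fullDesign-FlagTransitive : ∀ {n} (w : Which) k → 2 + k ≤ n → FlagTransitive (InG w) (fullDesign n k)
fullDesign-FlagTransitive {n} w k room α β S T S∈B α∈S T∈B β∈T =
  flagTransitive w (trans ∣S∣≡k (sym ∣T∣≡k)) (subst (λ l → 2 + l ≤ n) (sym ∣T∣≡k) room) α∈S β∈T
  where
  ∣S∣≡k : ∣ S ∣ ≡ k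
  ∣S∣≡k = Equivalence.to (fullDesign-≡true k S) S∈B
  ∣T∣≡k : ∣ T ∣ ≡ k
  ∣T∣≡k = Equivalence.to (fullDesign-≡true k T) T∈B

fullDesign-Good : ∀ {m k} (w : Which) → NonTrivial (2 + m) k → Good (2 + m) (InG w) (fullDesign (2 + m) k)
fullDesign-Good {m} {suc (suc (suc j))} w nonTrivial@(s≤s (s≤s (s≤s _)) , s≤s 3+j≤m) =
  (3 + j , m C (1 + j) , fullDesign-Is2Design m (1 + j) (ℕₚ.m+n≤o⇒n≤o 2 3+j≤m) , nonTrivial) ,
  fullDesign-IsAutGroup (InG w) (3 + j) ,
  fullDesign-FlagTransitive w (3 + j) (s≤s (s≤s 3+j≤m)) ,
  InG-primitive w (s≤s (s≤s (ℕₚ.m+n≤o⇒m≤o 2 3+j≤m)))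

InG-invariant⇒fullDesign : ∀ {n} (w : Which) {B : Blocks n} {k} → IsAutGroup (InG w) B →
  (∀ S → B S ≡ true → ∣ S ∣ ≡ k) → ∀ {S₀} → B S₀ ≡ true → 1 ≤ k → 2 + k ≤ n → B ≐ fullDesign n k
InG-invariant⇒fullDesign {n} w {B} {k} aut uniform {S₀} S₀∈B 1≤k room T =
  Boolₚ.⇔→≡ (mk⇔ (Equivalence.from (fullDesign-≡true k T) ∘ uniform T)
                 (reached ∘ Equivalence.to (fullDesign-≡true k T)))
  where
  reached : ∣ T ∣ ≡ k → B T ≡ true
  reached ∣T∣≡k =
    let (α , α∈S₀) = nonempty {p = S₀} (subst (1 ≤_) (sym (uniform S₀ S₀∈B)) 1≤k)
        (β , β∈T)  = nonempty {p = T} (subst (1 ≤_) (sym ∣T∣≡k) 1≤k)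
        (g , g∈G , _ , gS₀≡T) =
          flagTransitive w (trans (uniform S₀ S₀∈B) (sym ∣T∣≡k)) (subst (λ l → 2 + l ≤ n) (sym ∣T∣≡k) room) α∈S₀ β∈T
    in subst (λ S → B S ≡ true) gS₀≡T (aut g g∈G S₀ S₀∈B)

Good⇒fullDesign : ∀ {m} (w : Which) {B : Blocks (2 + m)} → Good (2 + m) (InG w) B →
  ∃ λ k → NonTrivial (2 + m) k × B ≐ fullDesign (2 + m) k
Good⇒fullDesign {m} w {B} ((k , lam , (uniform , pairs , 1≤lam) , nonTrivial@(2<k , k<1+m)) , aut , _) =
  k , nonTrivial , InG-invariant⇒fullDesign w aut uniform (Boolₚ.∧-conicalˡ _ _ (proj₂ block)) (ℕₚ.≤-trans (s≤s z≤n) 2<k)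
                     (s≤s (s≤s (ℕₚ.≤-pred k<1+m)))
  where
  block : ∃ λ S → B S ∧ has zero S ∧ has (suc zero) S ≡ true
  block = countSubsets-nonempty _ (subst (1 ≤_) (sym (pairs zero (suc zero) (λ ()))) 1≤lam)

fullDesign-injective : ∀ {n k l} → k ≤ n → fullDesign n k ≐ fullDesign n l → k ≡ l
fullDesign-injective {n} {k} {l} k≤n full-k≐full-l =
  trans (sym ∣I∣≡k) (Equivalence.to (fullDesign-≡true l I) (trans (sym (full-k≐full-l I)) I∈full-k))
  where
  I : Subset n
  I = initial k
  ∣I∣≡k : ∣ I ∣ ≡ k
  ∣I∣≡k = ∣initial∣ k k≤n
  I∈full-k : fullDesign n k I ≡ true
  I∈full-k = Equivalence.from (fullDesign-≡true k I) ∣I∣≡k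

NonTrivial⇒index : ∀ {m k} → NonTrivial (5 + m) k → ∃ λ (i : Fin (suc m)) → 3 + toℕ i ≡ k
NonTrivial⇒index (s≤s (s≤s (s≤s {n = j} _)) , s≤s (s≤s (s≤s j<1+m))) =
  Fin.fromℕ< j<1+m , cong (3 +_) (Finₚ.toℕ-fromℕ< j<1+m)

theorem1 : (n : ℕ) → 5 ≤ n → (w : Which) →
    Σ (Fin (n ∸ 4) → Blocks n) λ D →
      (∀ i j → D i ≐ D j → i ≡ j) ×
      (∀ i → Good n (InG w) (D i)) ×
      (∀ B → Good n (InG w) B → ∃ λ i → B ≐ D i) ×
      (∀ i → D i ≐ fullDesign n (3 + toℕ i) ×
             Is2Design n (D i) (3 + toℕ i) ((n ∸ 2) C (1 + toℕ i)) ×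
             countSubsets (D i) ≡ n C (3 + toℕ i) ×
             (∀ x → countSubsets (λ S → D i S ∧ has x S) ≡ (n ∸ 1) C (2 + toℕ i)))
theorem1 _ (s≤s (s≤s (s≤s (s≤s (s≤s {n = m} _))))) w =
  D , D-injective , D-Good , D-complete , λ i →
    (λ _ → refl) , fullDesign-Is2Design (3 + m) (1 + toℕ i) (1+i≤3+m i) ,
    countSubsets-fullDesign (5 + m) (3 + toℕ i) , countSubsets-fullDesign-∋ (4 + m) (2 + toℕ i)
  where
  D : Fin (suc m) → Blocks (5 + m)
  D i = fullDesign (5 + m) (3 + toℕ i)
  1+i≤3+m : ∀ (i : Fin (suc m)) → 1 + toℕ i ≤ 3 + m
  1+i≤3+m i = ℕₚ.≤-trans (Finₚ.toℕ<n i) (ℕₚ.m≤n+m (suc m) 2)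
  D-injective : ∀ i j → D i ≐ D j → i ≡ j
  D-injective i j Di≐Dj = Finₚ.toℕ-injective (ℕₚ.+-cancelˡ-≡ 3 _ _ (fullDesign-injective (s≤s (s≤s (1+i≤3+m i))) Di≐Dj))
  D-Good : ∀ i → Good (5 + m) (InG w) (D i)
  D-Good i = fullDesign-Good w (s≤s (s≤s (s≤s z≤n)) , s≤s (s≤s (s≤s (Finₚ.toℕ<n i))))
  D-complete : ∀ B → Good (5 + m) (InG w) B → ∃ λ i → B ≐ D i
  D-complete B good =
    let (k , nonTrivial , B≐full) = Good⇒fullDesign {3 + m} w {B} good
        (i , 3+i≡k) = NonTrivial⇒index nonTrivial
    in i , λ S → trans (B≐full S) (cong (λ l → fullDesign (5 + m) l S) (sym 3+i≡k))
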